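{- Let $p_1,\dots,p_m$ be a proper pin sequence in the plot of a permutation. Then for every $i$ with $2\le i<m$, the points $p_i$ and $p_{i+1}$ are separated either by $p_{i-1}$ or by each of $p_1,\dots,p_{i-2}$. Here a point $q$ separates two points $u,v$ if the vertical line or the horizontal line through $q$ strictly separates $u$ from $v$.
   Context: The plot of a permutation $\pi$ of $[n]$ is the point set $\{(i,\pi(i)):i\in[n]\}$. For points $q_1,\dots,q_m$, $\operatorname{rect}(q_1,\dots,q_m)$ is the smallest closed axes-parallel rectangle containing them. A pin sequence is a sequence of distinct points $p_1,\dots,p_m$ of the plot such that for each $i\ge3$, writing $\operatorname{rect}(p_1,\dots,p_{i-1})=[a,b]\times[c,d]$ and $p_i=(x,y)$: $p_i\notin\operatorname{rect}(p_1,\dots,p_{i-1})$ and either $a<x<b$ or $c<y<d$. Such $p_i$ is a left pin if $x<a$, right pin if $x>b$, up pin if $y>d$, down pin if $y<c$. The pin sequence is proper if (maximality) each $p_i$, $i\ge3$, is extreme in its direction among all points of the plot that could serve as a pin of that direction for $\operatorname{rect}(p_1,\dots,p_{i-1})$ (e.g. for a right pin $p_i=(x,y)$ there is no point of the plot in $(x,n]\times[c,d]$), and (separation) for each $i\ge2$ with $i+1\le m$, $p_{i+1}$ lies horizontally or vertically strictly between $\operatorname{rect}(p_1,\dots,p_{i-1})$ and $p_i$. (For $i=2$ the condition "each of $p_1,\dots,p_{0}$" is vacuous.) -}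

module Defs where

open import Data.Nat using (ℕ; zero; suc; _≤_; _<_; _⊔_; _⊓_; _∸_)
open import Data.Fin using (Fin; toℕ)
open import Data.Product using (_×_; _,_)
open import Data.Sum using (_⊎_)
open import Relation.Nullary using (¬_)
open import Relation.Binary.PropositionalEquality using (_≡_)
open import Function.Definitions using (Injective)

record Perm (n : ℕ) : Set where
  field
    fun : Fin n → Fin n
    inj : Injective _≡_ _≡_ fun
open Perm public

-- A point of the plot of π is determined by its x-coordinate i : Fin n;
-- the point is (i , π(i)).
X : ∀ {n} → Fin n → ℕ
X i = toℕ i

Y : ∀ {n} → Perm n → Fin n → ℕ
Y π i = toℕ (fun π i)

-- A sequence of points of the plot is p : ℕ → Fin n, meaningful at
-- indices 1 … m (values at other indices are irrelevant).

-- minimum / maximum of f 1, …, f k  (for k ≥ 1; junk value at k = 0)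
minUpTo : (ℕ → ℕ) → ℕ → ℕ
minUpTo f zero = f zero
minUpTo f (suc zero) = f 1
minUpTo f (suc (suc k)) = minUpTo f (suc k) ⊓ f (suc (suc k))

maxUpTo : (ℕ → ℕ) → ℕ → ℕ
maxUpTo f zero = f zero
maxUpTo f (suc zero) = f 1
maxUpTo f (suc (suc k)) = maxUpTo f (suc k) ⊔ f (suc (suc k))

record Rect : Set where
  constructor rect
  field
    a b c d : ℕ
open Rect public

rectOf : ∀ {n} → Perm n → (ℕ → Fin n) → ℕ → Rect
rectOf π p k =
  rect (minUpTo (λ j → X (p j)) k) (maxUpTo (λ j → X (p j)) k)
       (minUpTo (λ j → Y π (p j)) k) (maxUpTo (λ j → Y π (p j)) k)

InRect : ℕ → ℕ → Rect → Set
InRect x y R = (a R ≤ x × x ≤ b R) × (c R ≤ y × y ≤ d R)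

IsPinFor : ℕ → ℕ → Rect → Set
IsPinFor x y R = ¬ InRect x y R × ((a R < x × x < b R) ⊎ (c R < y × y < d R))

MaximalPin : ∀ {n} → Perm n → Fin n → Rect → Set
MaximalPin {n} π q R =
  (X q < a R → ∀ (r : Fin n) → X r < X q → ¬ (c R ≤ Y π r × Y π r ≤ d R))
  × (b R < X q → ∀ (r : Fin n) → X q < X r → ¬ (c R ≤ Y π r × Y π r ≤ d R))
  × (d R < Y π q → ∀ (r : Fin n) → Y π q < Y π r → ¬ (a R ≤ X r × X r ≤ b R))
  × (Y π q < c R → ∀ (r : Fin n) → Y π r < Y π q → ¬ (a R ≤ X r × X r ≤ b R))

StrictBetween : ℕ → ℕ → ℕ → Set
StrictBetween s u t = (s < u × u < t) ⊎ (t < u × u < s)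

BetweenRectAndPoint : ∀ {n} → Perm n → Rect → Fin n → Fin n → Set
BetweenRectAndPoint π R q q' =
  ((b R < X q' × X q' < X q) ⊎ (X q < X q' × X q' < a R))
  ⊎ ((d R < Y π q' × Y π q' < Y π q) ⊎ (Y π q < Y π q' × Y π q' < c R))

record PinSequence {n : ℕ} (π : Perm n) (p : ℕ → Fin n) (m : ℕ) : Set where
  field
    distinct : ∀ i j → 1 ≤ i → i ≤ m → 1 ≤ j → j ≤ m → p i ≡ p j → i ≡ j
    pin      : ∀ i → 3 ≤ i → i ≤ m →
               IsPinFor (X (p i)) (Y π (p i)) (rectOf π p (i ∸ 1))

record ProperPinSequence {n : ℕ} (π : Perm n) (p : ℕ → Fin n) (m : ℕ) : Set where
  field
    pinSeq     : PinSequence π p m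
    maximal    : ∀ i → 3 ≤ i → i ≤ m → MaximalPin π (p i) (rectOf π p (i ∸ 1))
    separation : ∀ i → 2 ≤ i → suc i ≤ m →
                 BetweenRectAndPoint π (rectOf π p (i ∸ 1)) (p i) (p (suc i))

Separates : ∀ {n} → Perm n → Fin n → Fin n → Fin n → Set
Separates π q u v =
  StrictBetween (X u) (X q) (X v) ⊎ StrictBetween (Y π u) (Y π q) (Y π v)

{-# OPTIONS --safe #-}
-- Write R_k for rect(p_1, …, p_k). By separation, p_i lies strictly between R_{i-2} and p_{i-1}
-- along some axis U, so R_{i-1} already spans p_i along U. The separation of p_{i+1} from R_{i-1}
-- therefore happens along the other axis, where R_i consequently spans p_{i+1}. Being a pin for R_i,
-- p_{i+1} must then leave R_i along U: either beyond p_{i-1}, which then separates p_i from p_{i+1},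
-- or on the opposite side, beyond all of p_1, …, p_{i-2}, which then all separate p_i from p_{i+1}.
module Submission where

open import Defs
open import Data.Nat using (ℕ; zero; suc; _+_; _≤_; _<_; _∸_; s≤s; z<s; _≤?_)
open import Data.Nat.Properties
open import Data.Fin using (Fin)
open import Data.Sum using (_⊎_; inj₁; inj₂)
import Data.Sum as Sum
open import Data.Product using (_×_; _,_; ∃-syntax)
open import Data.Empty using (⊥-elim)
open import Relation.Nullary using (¬_; yes; no)
open import Relation.Binary.PropositionalEquality using (_≡_; refl)
open ≤-Reasoning

InInterval : ℕ → ℕ → ℕ → Set
InInterval lo hi v = lo ≤ v × v ≤ hi

BetweenIntervalAndPoint : ℕ → ℕ → ℕ → ℕ → Set
BetweenIntervalAndPoint lo hi v w = (hi < w × w < v) ⊎ (v < w × w < lo)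

outside-interval : ∀ {lo hi v} → ¬ InInterval lo hi v → v < lo ⊎ hi < v
outside-interval {lo} {hi} {v} v∉ with lo ≤? v | v ≤? hi
... | no lo≰v  | _        = inj₁ (≰⇒> lo≰v)
... | yes _    | no v≰hi  = inj₂ (≰⇒> v≰hi)
... | yes lo≤v | yes v≤hi = ⊥-elim (v∉ (lo≤v , v≤hi))

between⇒∉interval : ∀ {lo hi v w} → BetweenIntervalAndPoint lo hi v w → ¬ InInterval lo hi v
between⇒∉interval (inj₁ (hi<w , w<v)) (_ , v≤hi) = <⇒≱ (<-trans hi<w w<v) v≤hi
between⇒∉interval (inj₂ (v<w , w<lo)) (lo≤v , _) = <⇒≱ (<-trans v<w w<lo) lo≤v

module _ (f : ℕ → ℕ) where

  Spanned : ℕ → ℕ → Set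
  Spanned k = InInterval (minUpTo f k) (maxUpTo f k)

  minUpTo-≤ : ∀ k {j} → 1 ≤ j → j ≤ k → minUpTo f k ≤ f j
  minUpTo-≤ (suc zero) z<s z<s = ≤-refl
  minUpTo-≤ (suc (suc k)) 1≤j j≤2+k with m≤n⇒m<n∨m≡n j≤2+k | minUpTo-≤ (suc k) 1≤j
  ... | inj₁ j<2+k | ih = ≤-trans (m⊓n≤m _ _) (ih (≤-pred j<2+k))
  ... | inj₂ refl  | _  = m⊓n≤n _ _

  ≤-maxUpTo : ∀ k {j} → 1 ≤ j → j ≤ k → f j ≤ maxUpTo f k
  ≤-maxUpTo (suc zero) z<s z<s = ≤-refl
  ≤-maxUpTo (suc (suc k)) 1≤j j≤2+k with m≤n⇒m<n∨m≡n j≤2+k | ≤-maxUpTo (suc k) 1≤j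
  ... | inj₁ j<2+k | ih = ≤-trans (ih (≤-pred j<2+k)) (m≤m⊔n _ _)
  ... | inj₂ refl  | _  = m≤n⊔m _ _

  between⇒spanned-next : ∀ k {w} →
    BetweenIntervalAndPoint (minUpTo f (1 + k)) (maxUpTo f (1 + k)) (f (2 + k)) w →
    Spanned (2 + k) w
  between⇒spanned-next k {w} (inj₁ (hi<w , w<new)) =
    lower , <⇒≤ (<-≤-trans w<new (≤-maxUpTo (2 + k) z<s ≤-refl))
    where
    lower : minUpTo f (2 + k) ≤ w
    lower = begin
      minUpTo f (2 + k) ≤⟨ minUpTo-≤ (2 + k) ≤-refl z<s ⟩
      f 1               ≤⟨ ≤-maxUpTo (1 + k) ≤-refl z<s ⟩
      maxUpTo f (1 + k) <⟨ hi<w ⟩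
      w                 ∎
  between⇒spanned-next k {w} (inj₂ (new<w , w<lo)) =
    <⇒≤ (≤-<-trans (minUpTo-≤ (2 + k) z<s ≤-refl) new<w) , upper
    where
    upper : w ≤ maxUpTo f (2 + k)
    upper = begin
      w                 <⟨ w<lo ⟩
      minUpTo f (1 + k) ≤⟨ minUpTo-≤ (1 + k) ≤-refl z<s ⟩
      f 1               ≤⟨ ≤-maxUpTo (2 + k) ≤-refl z<s ⟩
      maxUpTo f (2 + k) ∎

  previous-or-earlier-between : ∀ k →
    BetweenIntervalAndPoint (minUpTo f k) (maxUpTo f k) (f (1 + k)) (f (2 + k)) →
    ¬ Spanned (2 + k) (f (3 + k)) →
    StrictBetween (f (2 + k)) (f (1 + k)) (f (3 + k))
    ⊎ (∀ j → 1 ≤ j → j ≤ k → StrictBetween (f (2 + k)) (f j) (f (3 + k)))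
  previous-or-earlier-between k between next∉ with between | outside-interval next∉
  ... | inj₁ (_ , cur<prev) | inj₂ hi<next =
    inj₁ (inj₁ (cur<prev , ≤-<-trans (≤-maxUpTo (2 + k) z<s (n≤1+n _)) hi<next))
  ... | inj₂ (prev<cur , _) | inj₁ next<lo =
    inj₁ (inj₂ (<-≤-trans next<lo (minUpTo-≤ (2 + k) z<s (n≤1+n _)) , prev<cur))
  ... | inj₁ (hi<cur , _)   | inj₁ next<lo = inj₂ λ j 1≤j j≤k →
    inj₂ ( <-≤-trans next<lo (minUpTo-≤ (2 + k) 1≤j (m≤n⇒m≤o+n 2 j≤k))
         , ≤-<-trans (≤-maxUpTo k 1≤j j≤k) hi<cur)
  ... | inj₂ (_ , cur<lo)   | inj₂ hi<next = inj₂ λ j 1≤j j≤k →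
    inj₁ ( <-≤-trans cur<lo (minUpTo-≤ k 1≤j j≤k)
         , ≤-<-trans (≤-maxUpTo (2 + k) 1≤j (m≤n⇒m≤o+n 2 j≤k)) hi<next)

data Axis : Set where
  horizontal vertical : Axis

orthogonal : Axis → Axis
orthogonal horizontal = vertical
orthogonal vertical   = horizontal

same-or-orthogonal : ∀ U A → A ≡ U ⊎ A ≡ orthogonal U
same-or-orthogonal horizontal horizontal = inj₁ refl
same-or-orthogonal horizontal vertical   = inj₂ refl
same-or-orthogonal vertical   horizontal = inj₂ refl
same-or-orthogonal vertical   vertical   = inj₁ refl

module _ {n} (π : Perm n) (p : ℕ → Fin n) where

  coord : Axis → Fin n → ℕ
  coord horizontal = X
  coord vertical   = Y π

  along : Axis → ℕ → ℕ
  along A j = coord A (p j)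

  between-along : ∀ k {q q'} → BetweenRectAndPoint π (rectOf π p k) q q' →
    ∃[ A ] BetweenIntervalAndPoint (minUpTo (along A) k) (maxUpTo (along A) k) (coord A q) (coord A q')
  between-along _ (inj₁ between) = horizontal , between
  between-along _ (inj₂ between) = vertical , between

  pin-escapes-along : ∀ A k {q} → IsPinFor (X q) (Y π q) (rectOf π p k) →
    Spanned (along (orthogonal A)) k (coord (orthogonal A) q) → ¬ Spanned (along A) k (coord A q)
  pin-escapes-along horizontal _ (∉rect , _) inV inH = ∉rect (inH , inV)
  pin-escapes-along vertical   _ (∉rect , _) inH inV = ∉rect (inH , inV)

  separates-along : ∀ A {q u v} → StrictBetween (coord A u) (coord A q) (coord A v) → Separates π q u v
  separates-along horizontal = inj₁
  separates-along vertical   = inj₂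

  previous-or-earlier-separate : ∀ k →
    BetweenRectAndPoint π (rectOf π p (1 + k)) (p (2 + k)) (p (3 + k)) →
    BetweenRectAndPoint π (rectOf π p (2 + k)) (p (3 + k)) (p (4 + k)) →
    IsPinFor (X (p (4 + k))) (Y π (p (4 + k))) (rectOf π p (3 + k)) →
    Separates π (p (2 + k)) (p (3 + k)) (p (4 + k))
    ⊎ (∀ j → 1 ≤ j → j ≤ 1 + k → Separates π (p j) (p (3 + k)) (p (4 + k)))
  previous-or-earlier-separate k sep₁ sep₂ pin
    with between-along (1 + k) sep₁ | between-along (2 + k) sep₂
  ... | U , between₁ | A , between₂ with same-or-orthogonal U A
  ... | inj₁ refl = ⊥-elim (between⇒∉interval between₂ (between⇒spanned-next (along U) k between₁))
  ... | inj₂ refl =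
    Sum.map (separates-along U) (λ earlier j 1≤j j≤1+k → separates-along U (earlier j 1≤j j≤1+k))
      (previous-or-earlier-between (along U) (1 + k) between₁ next∉U)
    where
    next∉U : ¬ Spanned (along U) (3 + k) (along U (4 + k))
    next∉U = pin-escapes-along U (3 + k) pin (between⇒spanned-next (along (orthogonal U)) (1 + k) between₂)

lemma3p3 : ∀ {n : ℕ} (π : Perm n) (p : ℕ → Fin n) (m : ℕ) →
    ProperPinSequence π p m →
    ∀ (i : ℕ) → 2 ≤ i → i < m →
      Separates π (p (i ∸ 1)) (p i) (p (suc i))
      ⊎ (∀ (j : ℕ) → 1 ≤ j → j ≤ i ∸ 2 → Separates π (p j) (p i) (p (suc i)))
lemma3p3 π p m P (suc zero) (s≤s ()) _
lemma3p3 π p m P (suc (suc zero)) _ _ = inj₂ λ { _ z<s () }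
lemma3p3 π p m P (suc (suc (suc k))) _ i<m =
  previous-or-earlier-separate π p k
    (separation (2 + k) (s≤s z<s) (<⇒≤ i<m))
    (separation (3 + k) (s≤s z<s) i<m)
    (PinSequence.pin pinSeq (4 + k) (s≤s (s≤s z<s)) i<m)
  where open ProperPinSequence P
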